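{- Let $K$ be a finite simplicial complex with $m(K)\ge1$ vertices and $f_s(K)$ $s$-simplices, where $s\ge1$. Then \[ \chi^s(K,r)=r^{m(K)}-f_s(K)\,r^{m(K)-s}+R(r), \] where $R$ is a polynomial all of whose terms have degree strictly less than $m(K)-s$. Consequently the $s$-chromatic polynomial of $K$ determines $f_0(K)=m(K)$ and $f_s(K)$.
   Context: An $s$-simplex of $K$ is a face with $s+1$ vertices. An $(r,s)$-coloring of $K$ is a map $V(K)\to\{1,\dots,r\}$ with no monochrome $s$-simplex; $\chi^s(K,r)$, the number of such colorings, is a polynomial in $r$ (the $s$-chromatic polynomial). -}

module Defs where

open import Data.Bool using (Bool; true; false; not; _∧_; _∨_)
open import Data.Nat using (ℕ; zero; suc; _+_; _*_; _∸_; _≡ᵇ_)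
open import Data.Integer as ℤ using (ℤ)
open import Data.Fin using (Fin; toℕ)
open import Data.Fin.Subset using (Subset; _⊆_; ⁅_⁆; ∣_∣; inside; outside)
open import Data.Vec using (Vec; []; _∷_; lookup)
open import Data.List using (List; []; _∷_; map; _++_; length; filterᵇ; concatMap; allFin)
open import Data.Bool.ListAction using (all; any)
open import Relation.Binary.PropositionalEquality using (_≡_)

-- Faces are given by a Boolean predicate on subsets of Fin m; the family
-- is closed under taking subsets and every vertex {i} is a face, so K has
-- exactly m vertices.
record SimplicialComplex (m : ℕ) : Set where
  field
    isFace      : Subset m → Bool
    downClosed  : ∀ σ τ → τ ⊆ σ → isFace σ ≡ true → isFace τ ≡ true
    vertexFaces : ∀ i → isFace ⁅ i ⁆ ≡ true
open SimplicialComplex public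

subsets : (m : ℕ) → List (Subset m)
subsets zero    = [] ∷ []
subsets (suc m) = map (outside ∷_) (subsets m) ++ map (inside ∷_) (subsets m)

colourings : (m r : ℕ) → List (Vec (Fin r) m)
colourings zero    r = [] ∷ []
colourings (suc m) r = concatMap (λ k → map (k ∷_) (colourings m r)) (allFin r)

simplices : ∀ {m} (s : ℕ) → SimplicialComplex m → List (Subset m)
simplices {m} s K = filterᵇ (λ σ → isFace K σ ∧ (∣ σ ∣ ≡ᵇ suc s)) (subsets m)

f : ∀ {m} (s : ℕ) → SimplicialComplex m → ℕ
f s K = length (simplices s K)

_≟ᶠ_ : ∀ {r} → Fin r → Fin r → Bool
a ≟ᶠ b = toℕ a ≡ᵇ toℕ b

monochrome : ∀ {m r} → Vec (Fin r) m → Subset m → Bool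
monochrome {m} {r} c σ =
  any (λ k → all (λ i → not (lookup σ i) ∨ (lookup c i ≟ᶠ k)) (allFin m)) (allFin r)

isColouring : ∀ {m r} (s : ℕ) → SimplicialComplex m → Vec (Fin r) m → Bool
isColouring s K c = not (any (monochrome c) (simplices s K))

χ : ∀ {m} (s : ℕ) → SimplicialComplex m → ℕ → ℕ
χ {m} s K r = length (filterᵇ (isColouring s K) (colourings m r))

evalPoly : ∀ {n} → Vec ℤ n → ℤ → ℤ
evalPoly []       x = ℤ.+ 0
evalPoly (c ∷ cs) x = c ℤ.+ x ℤ.* evalPoly cs x

-- Let M_A(r) count the r-colourings in which every set of A is monochrome. Such a colouring is
-- constant on each class of the equivalence relation generated by A, so M_A(r) = r^c(A), where
-- c(A) is the number of classes. Inclusion–exclusion over the s-simplices H of K gives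
-- χ^s(K, r) = Σ_{A ⊆ H} (-1)^|A| r^c(A). Here c(∅) = m and c({σ}) = m - s, while c(A) < m - s
-- as soon as A contains two distinct s-simplices: if they meet, their ≥ s + 2 vertices lie in
-- one class; if not, their 2s + 2 vertices lie in two classes, and s ≥ 1. So
-- χ^s(K, r) = r^m - f_s r^(m-s) + lower terms, and comparing growth rates in r recovers m and f_s.

module Submission where

open import Defs
open import Algebra.Properties.CommutativeSemigroup using (interchange)
open import Data.Bool using (Bool; true; false; not; _∧_; _∨_; T)
open import Data.Bool.Properties using (T-≡; T-∧; T-∨; ∧-identityʳ; ∧-zeroʳ)
open import Data.Bool.ListAction using (all; any)
open import Data.Empty using (⊥; ⊥-elim)
open import Data.Fin using (Fin; zero; suc; toℕ)
import Data.Fin.Properties as Fin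
open import Data.Fin.Subset using (Subset; _∈_; _∉_; _⊆_; _⊂_; ∣_∣; ⁅_⁆; inside; outside)
open import Data.Fin.Subset.Properties
  using (_∈?_; ∣p∣≤n; p⊆q⇒∣p∣≤∣q∣; p⊂q⇒∣p∣<∣q∣; ⊆-antisym; x∈⁅x⁆; x∈⁅y⁆⇒x≡y; ∣⁅x⁆∣≡1;
         Empty-unique; ∣⊥∣≡0)
open import Data.Integer as ℤ using (ℤ; +_; -_)
import Data.Integer.Properties as ℤ
import Data.Integer.Tactic.RingSolver as ℤ-Ring
open import Data.List using (List; []; _∷_; map; _++_; length; filterᵇ; concatMap; allFin; tabulate)
import Data.List.Properties as List
open import Data.List.Membership.Propositional using (find; lose) renaming (_∈_ to _∈ₗ_)
open import Data.List.Membership.Propositional.Properties using (∈-allFin; ∈-map⁺; ∈-map⁻)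
open import Data.List.Relation.Unary.All as All using (All; []; _∷_)
import Data.List.Relation.Unary.All.Properties as Allₚ
open import Data.List.Relation.Unary.AllPairs using ([]; _∷_)
open import Data.List.Relation.Unary.Any as Any using (Any)
open import Data.List.Relation.Unary.Unique.Propositional using (Unique)
import Data.List.Relation.Unary.Unique.Propositional.Properties as Unique
open import Data.Nat using (ℕ; zero; suc; _+_; _*_; _∸_; _^_; _≤_; _<_; z≤n; s≤s; s≤s⁻¹; _≡ᵇ_)
open import Data.Nat.ListAction using (sum)
import Data.Nat.Properties as ℕ
open import Data.Nat.Properties using (<⇒≱)
import Data.Nat.Tactic.RingSolver as ℕ-Ring
open import Data.Product using (Σ; _×_; _,_; proj₁; proj₂; ∃)
open import Data.Sum using (_⊎_; inj₁; inj₂)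
open import Data.Unit using (tt)
open import Data.Vec as Vec using (Vec; []; _∷_; lookup; tail; replicate; padRight; zipWith; _[_]≔_; here; there)
open import Data.Vec.Properties
  using ([]=⇒lookup; lookup⇒[]=; []≔-updates; []≔-minimal; []≔-lookup; lookup∘update′; ∷-injectiveʳ)
open import Function using (_∘_; _$_; id; _⇔_; Equivalence; mk⇔; case_of_)
open import Relation.Binary.Definitions using (tri<; tri≈; tri>)
open import Relation.Binary.PropositionalEquality
open import Relation.Nullary using (¬_; Dec; yes; no)
open import Relation.Nullary.Decidable using (_×-dec_; ¬?; decidable-stable; T?)

private variable
  A B : Set
  m n r d d′ k : ℕ
  g h : ℕ → ℤ

T-ext : {a b : Bool} → (T a → T b) → (T b → T a) → a ≡ b
T-ext {false} {false} _ _ = refl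
T-ext {false} {true}  _ g with () ← g tt
T-ext {true}  {false} f _ with () ← f tt
T-ext {true}  {true}  _ _ = refl

T-all⁻ : (p : A → Bool) (xs : List A) → T (all p xs) → All (T ∘ p) xs
T-all⁻ p []       _ = []
T-all⁻ p (x ∷ xs) t = proj₁ (Equivalence.to T-∧ t) ∷ T-all⁻ p xs (proj₂ (Equivalence.to T-∧ t))

T-all⁺ : (p : A → Bool) {xs : List A} → All (T ∘ p) xs → T (all p xs)
T-all⁺ p []         = tt
T-all⁺ p (px ∷ pxs) = Equivalence.from T-∧ (px , T-all⁺ p pxs)

T-any⁻ : (p : A → Bool) (xs : List A) → T (any p xs) → ∃ (T ∘ p)
T-any⁻ p (x ∷ xs) t with Equivalence.to T-∨ t
... | inj₁ px = x , px
... | inj₂ t′ = T-any⁻ p xs t′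

T-any⁺ : (p : A → Bool) {xs : List A} {x : A} → x ∈ₗ xs → T (p x) → T (any p xs)
T-any⁺ p (Any.here refl) px = Equivalence.from T-∨ (inj₁ px)
T-any⁺ p (Any.there x∈xs) px = Equivalence.from T-∨ (inj₂ (T-any⁺ p x∈xs px))

≟ᶠ⇒≡ : (a b : Fin r) → T (a ≟ᶠ b) → a ≡ b
≟ᶠ⇒≡ a b t = Fin.toℕ-injective (ℕ.≡ᵇ⇒≡ (toℕ a) (toℕ b) t)

≡⇒≟ᶠ : (a b : Fin r) → a ≡ b → T (a ≟ᶠ b)
≡⇒≟ᶠ a b a≡b = ℕ.≡⇒≡ᵇ (toℕ a) (toℕ b) (cong toℕ a≡b)

Monochrome : Vec (Fin r) m → Subset m → Set
Monochrome {r} c σ = ∃ λ (k : Fin r) → ∀ {i} → i ∈ σ → lookup c i ≡ k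

monochrome⁻ : (c : Vec (Fin r) m) (σ : Subset m) → T (monochrome c σ) → Monochrome c σ
monochrome⁻ {r} {m} c σ t with T-any⁻ _ (allFin r) t
... | k , all-k = k , λ {i} i∈σ →
  ≟ᶠ⇒≡ _ k (subst (λ b → T (not b ∨ (lookup c i ≟ᶠ k))) ([]=⇒lookup i∈σ)
    (All.lookup (T-all⁻ _ (allFin m) all-k) (∈-allFin i)))

monochrome⁺ : (c : Vec (Fin r) m) (σ : Subset m) → Monochrome c σ → T (monochrome c σ)
monochrome⁺ {m = m} c σ (k , mono) = T-any⁺ _ (∈-allFin k) (T-all⁺ _ {allFin m} (All.tabulate λ {i} _ → vertex i))
  where
  vertex : ∀ i → T (not (lookup σ i) ∨ (lookup c i ≟ᶠ k))
  vertex i with lookup σ i in σᵢ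
  ... | false = tt
  ... | true  = ≡⇒≟ᶠ _ k (mono (lookup⇒[]= i σ σᵢ))

allMonochrome⁻ : (c : Vec (Fin r) m) (S : List (Subset m)) → T (all (monochrome c) S) → All (Monochrome c) S
allMonochrome⁻ c S t = All.map (monochrome⁻ c _) (T-all⁻ _ S t)

allMonochrome⁺ : (c : Vec (Fin r) m) (S : List (Subset m)) → All (Monochrome c) S → T (all (monochrome c) S)
allMonochrome⁺ c S mono = T-all⁺ _ (All.map (monochrome⁺ c _) mono)

-- Counting

𝟙 : Bool → ℕ
𝟙 true  = 1
𝟙 false = 0

count : (A → Bool) → List A → ℕ
count p xs = length (filterᵇ p xs)

count-∷ : (p : A → Bool) (x : A) (xs : List A) → count p (x ∷ xs) ≡ 𝟙 (p x) + count p xs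
count-∷ p x xs with p x
... | true  = refl
... | false = refl

count-cong : {p q : A → Bool} → (∀ x → p x ≡ q x) → ∀ xs → count p xs ≡ count q xs
count-cong p≗q []       = refl
count-cong {p = p} {q} p≗q (x ∷ xs) = begin
  count p (x ∷ xs)         ≡⟨ count-∷ p x xs ⟩
  𝟙 (p x) + count p xs     ≡⟨ cong₂ _+_ (cong 𝟙 (p≗q x)) (count-cong p≗q xs) ⟩
  𝟙 (q x) + count q xs     ≡⟨ count-∷ q x xs ⟨
  count q (x ∷ xs)         ∎
  where open ≡-Reasoning

count-++ : (p : A → Bool) (xs ys : List A) → count p (xs ++ ys) ≡ count p xs + count p ys
count-++ p []       ys = refl
count-++ p (x ∷ xs) ys = begin
  count p (x ∷ xs ++ ys)                ≡⟨ count-∷ p x (xs ++ ys) ⟩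
  𝟙 (p x) + count p (xs ++ ys)          ≡⟨ cong (_+_ (𝟙 (p x))) (count-++ p xs ys) ⟩
  𝟙 (p x) + (count p xs + count p ys)   ≡⟨ ℕ.+-assoc (𝟙 (p x)) _ _ ⟨
  𝟙 (p x) + count p xs + count p ys     ≡⟨ cong (_+ count p ys) (count-∷ p x xs) ⟨
  count p (x ∷ xs) + count p ys         ∎
  where open ≡-Reasoning

count-map : (p : A → Bool) (g : B → A) (ys : List B) → count p (map g ys) ≡ count (p ∘ g) ys
count-map p g []       = refl
count-map p g (y ∷ ys) = begin
  count p (g y ∷ map g ys)           ≡⟨ count-∷ p (g y) (map g ys) ⟩
  𝟙 (p (g y)) + count p (map g ys)   ≡⟨ cong (_+_ (𝟙 (p (g y)))) (count-map p g ys) ⟩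
  𝟙 (p (g y)) + count (p ∘ g) ys     ≡⟨ count-∷ (p ∘ g) y ys ⟨
  count (p ∘ g) (y ∷ ys)             ∎
  where open ≡-Reasoning

count-concatMap : (p : A → Bool) (g : B → List A) (ys : List B) →
                  count p (concatMap g ys) ≡ sum (map (count p ∘ g) ys)
count-concatMap p g []       = refl
count-concatMap p g (y ∷ ys) =
  trans (count-++ p (g y) (concatMap g ys)) (cong (_+_ (count p (g y))) (count-concatMap p g ys))

count-split : (p q : A → Bool) (xs : List A) →
              count p xs ≡ count (λ x → p x ∧ not (q x)) xs + count (λ x → p x ∧ q x) xs
count-split p q []       = refl
count-split {A = A} p q (x ∷ xs) = begin
  count p (x ∷ xs)
    ≡⟨ count-∷ p x xs ⟩
  𝟙 (p x) + count p xs
    ≡⟨ cong₂ _+_ (split (p x) (q x)) (count-split p q xs) ⟩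
  (𝟙 (p x ∧ not (q x)) + 𝟙 (p x ∧ q x)) + (count p∧¬q xs + count p∧q xs)
    ≡⟨ interchange ℕ.+-commutativeSemigroup (𝟙 (p x ∧ not (q x))) _ _ _ ⟩
  (𝟙 (p x ∧ not (q x)) + count p∧¬q xs) + (𝟙 (p x ∧ q x) + count p∧q xs)
    ≡⟨ cong₂ _+_ (count-∷ p∧¬q x xs) (count-∷ p∧q x xs) ⟨
  count p∧¬q (x ∷ xs) + count p∧q (x ∷ xs) ∎
  where
  open ≡-Reasoning
  p∧¬q p∧q : A → Bool
  p∧¬q x = p x ∧ not (q x)
  p∧q x = p x ∧ q x
  split : ∀ a b → 𝟙 a ≡ 𝟙 (a ∧ not b) + 𝟙 (a ∧ b)
  split true  true  = refl
  split true  false = refl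
  split false _     = refl

count-none : (xs : List A) → count (λ _ → false) xs ≡ 0
count-none []       = refl
count-none (_ ∷ xs) = count-none xs

count-≟ᶠ : (a : Fin r) → count (a ≟ᶠ_) (allFin r) ≡ 1
count-≟ᶠ {suc r} a = begin
  count (a ≟ᶠ_) (zero ∷ tabulate suc)
    ≡⟨ cong (λ ks → count (a ≟ᶠ_) (zero ∷ ks)) (List.map-tabulate id suc) ⟨
  count (a ≟ᶠ_) (zero ∷ map suc (allFin r))
    ≡⟨ count-∷ (a ≟ᶠ_) zero _ ⟩
  𝟙 (a ≟ᶠ zero) + count (a ≟ᶠ_) (map suc (allFin r))
    ≡⟨ cong (_+_ (𝟙 (a ≟ᶠ zero))) (count-map (a ≟ᶠ_) suc (allFin r)) ⟩
  𝟙 (a ≟ᶠ zero) + count ((a ≟ᶠ_) ∘ suc) (allFin r)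
    ≡⟨ shifted a ⟩
  1 ∎
  where
  open ≡-Reasoning
  shifted : (a : Fin (suc r)) → 𝟙 (a ≟ᶠ zero) + count ((a ≟ᶠ_) ∘ suc) (allFin r) ≡ 1
  shifted zero    = cong suc (count-none (allFin r))
  shifted (suc a) = count-≟ᶠ a

sum-map-cong : {f g : A → ℕ} → (∀ x → f x ≡ g x) → ∀ xs → sum (map f xs) ≡ sum (map g xs)
sum-map-cong f≗g xs = cong sum (List.map-cong f≗g xs)

sum-map-+ : (f g : A → ℕ) (xs : List A) → sum (map (λ x → f x + g x) xs) ≡ sum (map f xs) + sum (map g xs)
sum-map-+ f g []       = refl
sum-map-+ f g (x ∷ xs) = trans (cong (_+_ (f x + g x)) (sum-map-+ f g xs)) (interchange ℕ.+-commutativeSemigroup (f x) (g x) _ _)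

sum-map-const : (c : ℕ) (xs : List A) → sum (map (λ _ → c) xs) ≡ length xs * c
sum-map-const c []       = refl
sum-map-const c (x ∷ xs) = cong (_+_ c) (sum-map-const c xs)

sum-map-𝟙 : (p : A → Bool) (xs : List A) → sum (map (𝟙 ∘ p) xs) ≡ count p xs
sum-map-𝟙 p []       = refl
sum-map-𝟙 p (x ∷ xs) = trans (cong (_+_ (𝟙 (p x))) (sum-map-𝟙 p xs)) (sym (count-∷ p x xs))

count-fibres : (g : A → B → Bool) (q : A → Bool) (ks : List B) → (∀ a → count (g a) ks ≡ 1) →
               ∀ as → sum (map (λ k → count (λ a → g a k ∧ q a) as) ks) ≡ count q as
count-fibres g q ks unique [] = trans (sum-map-const 0 ks) (ℕ.*-zeroʳ (length ks))
count-fibres g q ks unique (a ∷ as) = begin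
  sum (map (λ k → count (λ a → g a k ∧ q a) (a ∷ as)) ks)
    ≡⟨ sum-map-cong (λ k → count-∷ (λ a → g a k ∧ q a) a as) ks ⟩
  sum (map (λ k → 𝟙 (g a k ∧ q a) + count (λ a → g a k ∧ q a) as) ks)
    ≡⟨ sum-map-+ (λ k → 𝟙 (g a k ∧ q a)) _ ks ⟩
  sum (map (λ k → 𝟙 (g a k ∧ q a)) ks) + sum (map (λ k → count (λ a → g a k ∧ q a) as) ks)
    ≡⟨ cong₂ _+_ (fibre (q a)) (count-fibres g q ks unique as) ⟩
  𝟙 (q a) + count q as
    ≡⟨ count-∷ q a as ⟨
  count q (a ∷ as) ∎
  where
  open ≡-Reasoning
  fibre : ∀ b → sum (map (λ k → 𝟙 (g a k ∧ b)) ks) ≡ 𝟙 b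
  fibre true  = trans (sum-map-cong (λ k → cong 𝟙 (∧-identityʳ (g a k))) ks)
                      (trans (sum-map-𝟙 (g a) ks) (unique a))
  fibre false = trans (sum-map-cong (λ k → cong 𝟙 (∧-zeroʳ (g a k))) ks)
                      (trans (sum-map-const 0 ks) (ℕ.*-zeroʳ (length ks)))

-- Subsets

⊆-[]≔inside : (p : Subset n) (j : Fin n) → p ⊆ p [ j ]≔ inside
⊆-[]≔inside p j {i} i∈p with i Fin.≟ j
... | yes refl = []≔-updates p j
... | no  i≢j  = []≔-minimal p i j i≢j i∈p

∈-[]≔inside⁻ : (p : Subset n) {i j : Fin n} → i ≢ j → i ∈ p [ j ]≔ inside → i ∈ p
∈-[]≔inside⁻ p {i} i≢j i∈p′ = lookup⇒[]= i p (trans (sym (lookup∘update′ i≢j p inside)) ([]=⇒lookup i∈p′))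

[]≔inside-∈ : (p : Subset n) {j : Fin n} → j ∈ p → p [ j ]≔ inside ≡ p
[]≔inside-∈ p {j} j∈p = trans (cong (p [ j ]≔_) (sym ([]=⇒lookup j∈p))) ([]≔-lookup p j)

⁅x⁆⊆ : {p : Subset n} {x : Fin n} → x ∈ p → ⁅ x ⁆ ⊆ p
⁅x⁆⊆ {x = x} x∈p y∈⁅x⁆ = subst (_∈ _) (sym (x∈⁅y⁆⇒x≡y x y∈⁅x⁆)) x∈p

∈⇒0<∣∣ : {p : Subset n} {x : Fin n} → x ∈ p → 0 < ∣ p ∣
∈⇒0<∣∣ {x = x} x∈p = subst (_≤ _) (∣⁅x⁆∣≡1 x) (p⊆q⇒∣p∣≤∣q∣ (⁅x⁆⊆ x∈p))

two-∈⇒1<∣∣ : {p : Subset n} {x y : Fin n} → x ∈ p → y ∈ p → x ≢ y → 1 < ∣ p ∣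
two-∈⇒1<∣∣ {x = x} {y} x∈p y∈p x≢y =
  subst (_< _) (∣⁅x⁆∣≡1 x)
    (p⊂q⇒∣p∣<∣q∣ (⁅x⁆⊆ x∈p , y , y∈p , λ y∈⁅x⁆ → x≢y (sym (x∈⁅y⁆⇒x≡y x y∈⁅x⁆))))

∉-all⇒∣∣≡0 : {p : Subset n} → (∀ i → i ∉ p) → ∣ p ∣ ≡ 0
∉-all⇒∣∣≡0 {n} none = trans (cong ∣_∣ (Empty-unique λ (i , i∈p) → none i i∈p)) (∣⊥∣≡0 n)

⊆-or-∃∉ : (p q : Subset n) → p ⊆ q ⊎ ∃ λ x → x ∈ p × x ∉ q
⊆-or-∃∉ p q with Fin.any? (λ x → (x ∈? p) ×-dec ¬? (x ∈? q))
... | yes witness = inj₂ witness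
... | no  none    = inj₁ λ {x} x∈p → decidable-stable (x ∈? q) (λ x∉q → none (x , x∈p , x∉q))

∃-other-∈ : {p : Subset n} {x : Fin n} → x ∈ p → 1 < ∣ p ∣ → ∃ λ y → y ∈ p × x ≢ y
∃-other-∈ {p = p} {x} x∈p 1<∣p∣ with ⊆-or-∃∉ p ⁅ x ⁆
... | inj₂ (y , y∈p , y∉⁅x⁆) = y , y∈p , λ { refl → y∉⁅x⁆ (x∈⁅x⁆ x) }
... | inj₁ p⊆⁅x⁆ = ⊥-elim (<⇒≱ 1<∣p∣ (subst (∣ p ∣ ≤_) (∣⁅x⁆∣≡1 x) (p⊆q⇒∣p∣≤∣q∣ p⊆⁅x⁆)))

∃-∈-∉ : {p q : Subset n} → ∣ p ∣ ≤ ∣ q ∣ → p ≢ q → ∃ λ x → x ∈ q × x ∉ p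
∃-∈-∉ {p = p} {q} ∣p∣≤∣q∣ p≢q with ⊆-or-∃∉ q p
... | inj₂ witness = witness
... | inj₁ q⊆p with ⊆-or-∃∉ p q
...   | inj₁ p⊆q = ⊥-elim (p≢q (⊆-antisym p⊆q q⊆p))
...   | inj₂ (x , x∈p , x∉q) = ⊥-elim (<⇒≱ (p⊂q⇒∣p∣<∣q∣ (q⊆p , x , x∈p , x∉q)) ∣p∣≤∣q∣)

-- Components of a family of subsets

Linked : List (Subset (suc n)) → Fin n → Set
Linked S j = Any (λ σ → zero ∈ σ × suc j ∈ σ) S

linked? : (S : List (Subset (suc n))) → Dec (∃ (Linked S))
linked? S = Fin.any? λ j → Any.any? (λ σ → (zero ∈? σ) ×-dec (suc j ∈? σ)) S

glue : Fin n → Fin (suc n) → Fin n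
glue j zero    = j
glue j (suc i) = i

glueˢ : Fin n → Subset (suc n) → Subset n
glueˢ j (inside  ∷ σ) = σ [ j ]≔ inside
glueˢ j (outside ∷ σ) = σ

-- The number of classes of the equivalence relation on Fin n generated by S. If vertex 0 shares
-- a set with vertex suc j, it is glued onto j (glueˢ j σ is the image of σ under glue j);
-- otherwise it is a class of its own and is dropped.
components : (n : ℕ) → List (Subset n) → ℕ
components zero    S = 0
components (suc n) S with linked? S
... | yes (j , _) = components n (map (glueˢ j) S)
... | no  _       = suc (components n (map tail S))

∈-glueˢ⁺ : (j : Fin n) (σ : Subset (suc n)) {x : Fin (suc n)} → x ∈ σ → glue j x ∈ glueˢ j σ
∈-glueˢ⁺ j (inside ∷ σ) here        = []≔-updates σ j
∈-glueˢ⁺ j (inside ∷ σ) (there x∈σ) = ⊆-[]≔inside σ j x∈σ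
∈-glueˢ⁺ j (outside ∷ σ) (there x∈σ) = x∈σ

∈-glueˢ⁻ : (j : Fin n) (σ : Subset (suc n)) {i : Fin n} → i ∈ glueˢ j σ → ∃ λ x → x ∈ σ × glue j x ≡ i
∈-glueˢ⁻ j (outside ∷ σ) i∈σ′ = suc _ , there i∈σ′ , refl
∈-glueˢ⁻ j (inside ∷ σ) {i} i∈σ′ with i Fin.≟ j
... | yes refl = zero , here , refl
... | no  i≢j  = suc i , there (∈-[]≔inside⁻ σ i≢j i∈σ′) , refl

lookup-glue : (j : Fin n) (c : Vec (Fin r) n) → ∀ x → lookup (lookup c j ∷ c) x ≡ lookup c (glue j x)
lookup-glue j c zero    = refl
lookup-glue j c (suc x) = refl

glue-≢ : {i j : Fin n} (y : Fin (suc n)) → i ≢ j → suc i ≢ y → i ≢ glue j y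
glue-≢ zero    i≢j _    = i≢j
glue-≢ (suc y) _   si≢y = si≢y ∘ cong suc

monochrome-glue : (j : Fin n) (c : Vec (Fin r) n) (σ : Subset (suc n)) →
                  Monochrome (lookup c j ∷ c) σ ⇔ Monochrome c (glueˢ j σ)
monochrome-glue j c σ = mk⇔
  (λ (k , mono) → k , λ i∈σ′ → case ∈-glueˢ⁻ j σ i∈σ′ of λ where
     (x , x∈σ , refl) → trans (sym (lookup-glue j c x)) (mono x∈σ))
  (λ (k , mono) → k , λ {x} x∈σ → trans (lookup-glue j c x) (mono (∈-glueˢ⁺ j σ x∈σ)))

allMonochrome-linked : {S : List (Subset (suc n))} {j : Fin n} → Linked S j → (k : Fin r) (c : Vec (Fin r) n) →
  all (monochrome (k ∷ c)) S ≡ (lookup c j ≟ᶠ k) ∧ all (monochrome c) (map (glueˢ j) S)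
allMonochrome-linked {S = S} {j} linked k c = T-ext forward backward
  where
  glued : All (Monochrome (lookup c j ∷ c)) S → T (all (monochrome c) (map (glueˢ j) S))
  glued mono = allMonochrome⁺ c _ (Allₚ.map⁺ (All.map (Equivalence.to (monochrome-glue j c _)) mono))
  forward : T (all (monochrome (k ∷ c)) S) → T ((lookup c j ≟ᶠ k) ∧ all (monochrome c) (map (glueˢ j) S))
  forward t with find linked
  ... | σ , σ∈S , 0∈σ , j∈σ =
    let mono = allMonochrome⁻ (k ∷ c) S t
        cⱼ≡k = trans (proj₂ (All.lookup mono σ∈S) j∈σ) (sym (proj₂ (All.lookup mono σ∈S) 0∈σ))
    in Equivalence.from T-∧ (≡⇒≟ᶠ _ k cⱼ≡k , glued (subst (λ k → All (Monochrome (k ∷ c)) S) (sym cⱼ≡k) mono))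
  backward : T ((lookup c j ≟ᶠ k) ∧ all (monochrome c) (map (glueˢ j) S)) → T (all (monochrome (k ∷ c)) S)
  backward t with Equivalence.to T-∧ t
  ... | cⱼ≟k , rest =
    allMonochrome⁺ (k ∷ c) S (subst (λ k → All (Monochrome (k ∷ c)) S) (≟ᶠ⇒≡ _ k cⱼ≟k)
      (All.map (Equivalence.from (monochrome-glue j c _)) (Allₚ.map⁻ (allMonochrome⁻ c _ rest))))

unlinked-isolated : {S : List (Subset (suc n))} → ¬ ∃ (Linked S) → ∀ {σ} → (inside ∷ σ) ∈ₗ S → ∀ i → i ∉ σ
unlinked-isolated unlinked σ∈S i i∈σ = unlinked (i , lose σ∈S (here , there i∈σ))

allMonochrome-unlinked : {S : List (Subset (suc n))} → ¬ ∃ (Linked S) → (k : Fin r) (c : Vec (Fin r) n) →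
  all (monochrome (k ∷ c)) S ≡ all (monochrome c) (map tail S)
allMonochrome-unlinked {S = S} unlinked k c = T-ext
  (λ t → allMonochrome⁺ c _ (Allₚ.map⁺ (All.map restrict (allMonochrome⁻ (k ∷ c) S t))))
  (λ t → allMonochrome⁺ (k ∷ c) S (All.tabulate λ σ∈S →
            extend σ∈S (All.lookup (Allₚ.map⁻ (allMonochrome⁻ c _ t)) σ∈S)))
  where
  restrict : ∀ {σ} → Monochrome (k ∷ c) σ → Monochrome c (tail σ)
  restrict {_ ∷ σ} (col , mono) = col , λ i∈σ → mono (there i∈σ)
  extend : ∀ {σ} → σ ∈ₗ S → Monochrome c (tail σ) → Monochrome (k ∷ c) σ
  extend {outside ∷ σ} _ (col , mono) = col , λ where (there i∈σ) → mono i∈σ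
  extend {inside ∷ σ} σ∈S _ = k , λ where
    here → refl
    (there {i = i} i∈σ) → ⊥-elim (unlinked-isolated unlinked σ∈S i i∈σ)

monochromeCount : (n r : ℕ) → List (Subset n) → ℕ
monochromeCount n r S = count (λ c → all (monochrome c) S) (colourings n r)

count-colourings-suc : (n r : ℕ) (p : Vec (Fin r) (suc n) → Bool) →
  count p (colourings (suc n) r) ≡ sum (map (λ k → count (p ∘ (k ∷_)) (colourings n r)) (allFin r))
count-colourings-suc n r p = trans (count-concatMap p (λ k → map (k ∷_) (colourings n r)) (allFin r))
                                       (sum-map-cong (λ k → count-map p (k ∷_) (colourings n r)) (allFin r))

monochromeCount-suc : ∀ n r (S : List (Subset n)) → monochromeCount n (suc r) S ≡ suc r ^ components n S
monochromeCount-suc zero r S = trans (count-∷ (λ c → all (monochrome c) S) [] []) $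
  cong (λ b → 𝟙 b + 0) (Equivalence.to T-≡ (allMonochrome⁺ {r = suc r} [] S (All.tabulate λ _ → zero , λ { {()} })))
monochromeCount-suc (suc n) r S with linked? S
... | yes (j , linked) = begin
  count (λ c → all (monochrome c) S) (colourings (suc n) (suc r))
    ≡⟨ count-colourings-suc n (suc r) (λ c → all (monochrome c) S) ⟩
  sum (map (λ k → count (λ c → all (monochrome (k ∷ c)) S) cs) (allFin (suc r)))
    ≡⟨ sum-map-cong (λ k → count-cong (allMonochrome-linked linked k) cs) (allFin (suc r)) ⟩
  sum (map (λ k → count (λ c → (lookup c j ≟ᶠ k) ∧ all (monochrome c) S′) cs) (allFin (suc r)))
    ≡⟨ count-fibres (λ c k → lookup c j ≟ᶠ k) _ (allFin (suc r)) (λ c → count-≟ᶠ (lookup c j)) cs ⟩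
  monochromeCount n (suc r) S′
    ≡⟨ monochromeCount-suc n r S′ ⟩
  suc r ^ components n S′ ∎
  where
  open ≡-Reasoning
  cs = colourings n (suc r)
  S′ = map (glueˢ j) S
... | no unlinked = begin
  count (λ c → all (monochrome c) S) (colourings (suc n) (suc r))
    ≡⟨ count-colourings-suc n (suc r) (λ c → all (monochrome c) S) ⟩
  sum (map (λ k → count (λ c → all (monochrome (k ∷ c)) S) cs) (allFin (suc r)))
    ≡⟨ sum-map-cong (λ k → trans (count-cong (allMonochrome-unlinked unlinked k) cs) (monochromeCount-suc n r S′))
                    (allFin (suc r)) ⟩
  sum (map (λ _ → suc r ^ components n S′) (allFin (suc r)))
    ≡⟨ sum-map-const (suc r ^ components n S′) (allFin (suc r)) ⟩
  length (allFin (suc r)) * suc r ^ components n S′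
    ≡⟨ cong (_* suc r ^ components n S′) (List.length-tabulate {n = suc r} id) ⟩
  suc r * suc r ^ components n S′ ∎
  where
  open ≡-Reasoning
  cs = colourings n (suc r)
  S′ = map tail S

components-suc-pos : ∀ n (S : List (Subset (suc n))) → 0 < components (suc n) S
components-suc-pos n S with linked? S
components-suc-pos zero    S | yes (() , _)
components-suc-pos (suc n) S | yes (j , _) = components-suc-pos n (map (glueˢ j) S)
... | no _ = s≤s z≤n

monochromeCount≡ : ∀ n r (S : List (Subset n)) → 0 < n → monochromeCount n r S ≡ r ^ components n S
monochromeCount≡ n       (suc r) S _ = monochromeCount-suc n r S
monochromeCount≡ (suc n) zero    S _ with components (suc n) S | components-suc-pos n S
... | suc e | _ = refl

∣∣≤1+∣glueˢ∣ : (j : Fin n) (σ : Subset (suc n)) → ∣ σ ∣ ≤ suc ∣ glueˢ j σ ∣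
∣∣≤1+∣glueˢ∣ j (inside  ∷ σ) = s≤s (p⊆q⇒∣p∣≤∣q∣ (⊆-[]≔inside σ j))
∣∣≤1+∣glueˢ∣ j (outside ∷ σ) = ℕ.n≤1+n ∣ σ ∣

components-[] : ∀ n → components n [] ≡ n
components-[] zero = refl
components-[] (suc n) with linked? {n} []
... | yes (_ , ())
... | no  _       = cong suc (components-[] n)

components-⁅σ⁆ : ∀ n (σ : Subset n) → components n (σ ∷ []) ≡ n ∸ (∣ σ ∣ ∸ 1)
components-⁅σ⁆ zero    [] = refl
components-⁅σ⁆ (suc n) σ with linked? (σ ∷ [])
components-⁅σ⁆ (suc n) (inside ∷ σ) | yes (j , Any.here (_ , there j∈σ))
  rewrite []≔inside-∈ σ j∈σ = trans (components-⁅σ⁆ n σ) (pred-∸ ∣ σ ∣ (∈⇒0<∣∣ j∈σ))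
  where
  pred-∸ : ∀ k → 0 < k → n ∸ (k ∸ 1) ≡ suc n ∸ k
  pred-∸ (suc k) _ = refl
components-⁅σ⁆ (suc n) (outside ∷ σ) | yes (_ , Any.here (() , _))
components-⁅σ⁆ (suc n) (outside ∷ σ) | no _ =
  trans (cong suc (components-⁅σ⁆ n σ)) (sym (ℕ.+-∸-assoc 1 (ℕ.≤-trans (ℕ.m∸n≤m ∣ σ ∣ 1) (∣p∣≤n σ))))
components-⁅σ⁆ (suc n) (inside ∷ σ) | no unlinked = begin
  suc (components n (σ ∷ []))  ≡⟨ cong suc (components-⁅σ⁆ n σ) ⟩
  suc (n ∸ (∣ σ ∣ ∸ 1))        ≡⟨ cong (λ k → suc (n ∸ (k ∸ 1))) ∣σ∣≡0 ⟩
  suc n                        ≡⟨ cong (suc n ∸_) ∣σ∣≡0 ⟨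
  suc n ∸ ∣ σ ∣                ∎
  where
  open ≡-Reasoning
  ∣σ∣≡0 = ∉-all⇒∣∣≡0 (unlinked-isolated unlinked (Any.here refl))

components≤ : ∀ n (S : List (Subset n)) → components n S ≤ n
components≤ zero    S = z≤n
components≤ (suc n) S with linked? S
... | yes (j , _) = ℕ.m≤n⇒m≤1+n (components≤ n (map (glueˢ j) S))
... | no  _       = s≤s (components≤ n (map tail S))

components+∣∣≤ : ∀ n {S : List (Subset n)} {σ} → σ ∈ₗ S → components n S + ∣ σ ∣ ≤ suc n
components+∣∣≤ zero {σ = []} _ = z≤n
components+∣∣≤ (suc n) {S} {σ} σ∈S with linked? S
... | yes (j , _) = begin
  components n S′ + ∣ σ ∣              ≤⟨ ℕ.+-monoʳ-≤ (components n S′) (∣∣≤1+∣glueˢ∣ j σ) ⟩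
  components n S′ + suc ∣ glueˢ j σ ∣  ≡⟨ ℕ.+-suc (components n S′) _ ⟩
  suc (components n S′ + ∣ glueˢ j σ ∣) ≤⟨ s≤s (components+∣∣≤ n (∈-map⁺ (glueˢ j) σ∈S)) ⟩
  suc (suc n)                          ∎
  where
  open ℕ.≤-Reasoning
  S′ = map (glueˢ j) S
... | no unlinked = isolated σ σ∈S
  where
  isolated : ∀ σ → σ ∈ₗ S → suc (components n (map tail S)) + ∣ σ ∣ ≤ suc (suc n)
  isolated (outside ∷ σ) σ∈S = s≤s (components+∣∣≤ n (∈-map⁺ tail σ∈S))
  isolated (inside ∷ σ) σ∈S rewrite ∉-all⇒∣∣≡0 (unlinked-isolated unlinked σ∈S)
                                   | ℕ.+-comm (components n (map tail S)) 1 = s≤s (s≤s (components≤ n _))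

components+∣∣< : ∀ n {S : List (Subset n)} {σ τ : Subset n} {x y : Fin n} →
                 σ ∈ₗ S → τ ∈ₗ S → x ∈ τ → y ∈ τ → x ≢ y → x ∉ σ → components n S + ∣ σ ∣ ≤ n
components+∣∣< zero {x = ()}
components+∣∣< (suc n) {S} {σ} {τ} {x} {y} σ∈S τ∈S x∈τ y∈τ x≢y x∉σ with linked? S
... | yes (j , _) = glued σ x σ∈S x∈τ x≢y x∉σ
  where
  S′ = map (glueˢ j) S
  viaSize : ∀ {σ} → σ ∈ₗ S → ∣ σ ∣ ≤ ∣ glueˢ j σ ∣ → components n S′ + ∣ σ ∣ ≤ suc n
  viaSize σ∈S le = ℕ.≤-trans (ℕ.+-monoʳ-≤ _ le) (components+∣∣≤ n (∈-map⁺ (glueˢ j) σ∈S))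
  glued : ∀ σ x → σ ∈ₗ S → x ∈ τ → x ≢ y → x ∉ σ → components n S′ + ∣ σ ∣ ≤ suc n
  glued (outside ∷ σ) _ σ∈S _ _ _ = viaSize σ∈S ℕ.≤-refl
  glued (inside ∷ σ) x σ∈S x∈τ x≢y x∉σ with j ∈? σ
  ... | no j∉σ = viaSize σ∈S (p⊂q⇒∣p∣<∣q∣ (⊆-[]≔inside σ j , j , []≔-updates σ j , j∉σ))
  glued (inside ∷ σ) zero    σ∈S x∈τ x≢y x∉σ | yes _ = ⊥-elim (x∉σ here)
  glued (inside ∷ σ) (suc i) σ∈S x∈τ x≢y x∉σ | yes j∈σ = begin
    components n S′ + suc ∣ σ ∣
      ≡⟨ ℕ.+-suc (components n S′) ∣ σ ∣ ⟩
    suc (components n S′ + ∣ σ ∣)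
      ≡⟨ cong (λ p → suc (components n S′ + ∣ p ∣)) ([]≔inside-∈ σ j∈σ) ⟨
    suc (components n S′ + ∣ glueˢ j (inside ∷ σ) ∣)
      ≤⟨ s≤s (components+∣∣< n (∈-map⁺ (glueˢ j) σ∈S) (∈-map⁺ (glueˢ j) τ∈S)
                (∈-glueˢ⁺ j τ x∈τ) (∈-glueˢ⁺ j τ y∈τ) (glue-≢ y i≢j x≢y) i∉σ′) ⟩
    suc n ∎
    where
    open ℕ.≤-Reasoning
    i≢j : i ≢ j
    i≢j refl = x∉σ (there j∈σ)
    i∉σ′ : i ∉ glueˢ j (inside ∷ σ)
    i∉σ′ i∈σ′ = x∉σ (there (∈-[]≔inside⁻ σ i≢j i∈σ′))
... | no unlinked = isolated σ τ x y σ∈S τ∈S x∈τ y∈τ x≢y x∉σ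
  where
  S′ = map tail S
  isolated : ∀ σ τ x y → σ ∈ₗ S → τ ∈ₗ S → x ∈ τ → y ∈ τ → x ≢ y → x ∉ σ →
             suc (components n S′) + ∣ σ ∣ ≤ suc n
  isolated _ _ zero zero _ _ _ _ x≢y _ = ⊥-elim (x≢y refl)
  isolated _ (inside ∷ τ) zero (suc b) _ τ∈S _ (there b∈τ) _ _ = ⊥-elim (unlinked-isolated unlinked τ∈S b b∈τ)
  isolated _ (inside ∷ τ) (suc a) _ _ τ∈S (there a∈τ) _ _ _ = ⊥-elim (unlinked-isolated unlinked τ∈S a a∈τ)
  isolated (outside ∷ σ) (outside ∷ τ) (suc a) (suc b) σ∈S τ∈S (there a∈τ) (there b∈τ) x≢y x∉σ =
    s≤s (components+∣∣< n (∈-map⁺ tail σ∈S) (∈-map⁺ tail τ∈S) a∈τ b∈τ (x≢y ∘ cong suc) (x∉σ ∘ there))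
  isolated (inside ∷ σ) (outside ∷ τ) (suc a) (suc b) σ∈S τ∈S (there a∈τ) (there b∈τ) x≢y _
    rewrite ∉-all⇒∣∣≡0 (unlinked-isolated unlinked σ∈S) = s≤s (s≤s⁻¹ (begin
      suc (components n S′ + 1) ≡⟨ ℕ.+-suc (components n S′) 1 ⟨
      components n S′ + 2       ≤⟨ ℕ.+-monoʳ-≤ (components n S′) (two-∈⇒1<∣∣ a∈τ b∈τ (x≢y ∘ cong suc)) ⟩
      components n S′ + ∣ τ ∣   ≤⟨ components+∣∣≤ n (∈-map⁺ tail τ∈S) ⟩
      suc n                     ∎))
    where open ℕ.≤-Reasoning

components<∸ : ∀ n s {S : List (Subset n)} {σ τ : Subset n} → 0 < s → σ ∈ₗ S → τ ∈ₗ S → σ ≢ τ →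
               ∣ σ ∣ ≡ suc s → ∣ τ ∣ ≡ suc s → components n S < n ∸ s
components<∸ n s {S} 0<s σ∈S τ∈S σ≢τ ∣σ∣≡1+s ∣τ∣≡1+s
  with x , x∈τ , x∉σ ← ∃-∈-∉ (ℕ.≤-reflexive (trans ∣σ∣≡1+s (sym ∣τ∣≡1+s))) σ≢τ
  with y , y∈τ , x≢y ← ∃-other-∈ x∈τ (subst (1 <_) (sym ∣τ∣≡1+s) (s≤s 0<s)) =
  ℕ.m+n≤o⇒m≤o∸n (suc (components n S))
    (subst (_≤ n) (trans (cong (_+_ (components n S)) ∣σ∣≡1+s) (ℕ.+-suc (components n S) s))
      (components+∣∣< n σ∈S τ∈S x∈τ y∈τ x≢y x∉σ))

-- Polynomial functions of bounded degree

Poly< : ℕ → (ℕ → ℤ) → Set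
Poly< d g = Σ (Vec ℤ d) λ v → ∀ r → g r ≡ evalPoly v (+ r)

monomial : ℤ → (k : ℕ) → Vec ℤ (suc k)
monomial c zero    = c ∷ []
monomial c (suc k) = + 0 ∷ monomial c k

module _ (x : ℤ) where

  evalPoly-replicate : ∀ d → evalPoly (replicate d (+ 0)) x ≡ + 0
  evalPoly-replicate zero    = refl
  evalPoly-replicate (suc d) rewrite evalPoly-replicate d = trans (ℤ.+-identityˡ (x ℤ.* + 0)) (ℤ.*-zeroʳ x)

  evalPoly-padRight : (d≤d′ : d ≤ d′) (v : Vec ℤ d) → evalPoly (padRight d≤d′ (+ 0) v) x ≡ evalPoly v x
  evalPoly-padRight {d′ = d′} z≤n []     = evalPoly-replicate d′
  evalPoly-padRight (s≤s d≤d′) (c ∷ v) = cong (λ e → c ℤ.+ x ℤ.* e) (evalPoly-padRight d≤d′ v)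

  evalPoly-zipWith : (u v : Vec ℤ d) → evalPoly (zipWith ℤ._+_ u v) x ≡ evalPoly u x ℤ.+ evalPoly v x
  evalPoly-zipWith []      []      = refl
  evalPoly-zipWith (a ∷ u) (b ∷ v) = begin
    a ℤ.+ b ℤ.+ x ℤ.* evalPoly (zipWith ℤ._+_ u v) x
      ≡⟨ cong (λ e → a ℤ.+ b ℤ.+ x ℤ.* e) (evalPoly-zipWith u v) ⟩
    a ℤ.+ b ℤ.+ x ℤ.* (evalPoly u x ℤ.+ evalPoly v x)
      ≡⟨ cong (λ e → a ℤ.+ b ℤ.+ e) (ℤ.*-distribˡ-+ x (evalPoly u x) (evalPoly v x)) ⟩
    a ℤ.+ b ℤ.+ (x ℤ.* evalPoly u x ℤ.+ x ℤ.* evalPoly v x)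
      ≡⟨ interchange ℤ.+-commutativeSemigroup a b _ _ ⟩
    a ℤ.+ x ℤ.* evalPoly u x ℤ.+ (b ℤ.+ x ℤ.* evalPoly v x) ∎
    where open ≡-Reasoning

  evalPoly-neg : (v : Vec ℤ d) → evalPoly (Vec.map -_ v) x ≡ - evalPoly v x
  evalPoly-neg []      = refl
  evalPoly-neg (c ∷ v) = begin
    - c ℤ.+ x ℤ.* evalPoly (Vec.map -_ v) x  ≡⟨ cong (λ e → - c ℤ.+ x ℤ.* e) (evalPoly-neg v) ⟩
    - c ℤ.+ x ℤ.* - evalPoly v x         ≡⟨ cong (λ e → - c ℤ.+ e) (ℤ.neg-distribʳ-* x (evalPoly v x)) ⟨
    - c ℤ.+ - (x ℤ.* evalPoly v x)       ≡⟨ ℤ.neg-distrib-+ c (x ℤ.* evalPoly v x) ⟨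
    - (c ℤ.+ x ℤ.* evalPoly v x)         ∎
    where open ≡-Reasoning

  evalPoly-monomial : (c : ℤ) (k : ℕ) → evalPoly (monomial c k) x ≡ c ℤ.* x ℤ.^ k
  evalPoly-monomial c zero    = begin
    c ℤ.+ x ℤ.* + 0  ≡⟨ cong (λ e → c ℤ.+ e) (ℤ.*-zeroʳ x) ⟩
    c ℤ.+ + 0        ≡⟨ ℤ.+-identityʳ c ⟩
    c                ≡⟨ ℤ.*-identityʳ c ⟨
    c ℤ.* ℤ.1ℤ       ∎
    where open ≡-Reasoning
  evalPoly-monomial c (suc k) = begin
    + 0 ℤ.+ x ℤ.* evalPoly (monomial c k) x  ≡⟨ ℤ.+-identityˡ _ ⟩
    x ℤ.* evalPoly (monomial c k) x          ≡⟨ cong (x ℤ.*_) (evalPoly-monomial c k) ⟩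
    x ℤ.* (c ℤ.* x ℤ.^ k)                    ≡⟨ ℤ.*-assoc x c _ ⟨
    x ℤ.* c ℤ.* x ℤ.^ k                      ≡⟨ cong (ℤ._* x ℤ.^ k) (ℤ.*-comm x c) ⟩
    c ℤ.* x ℤ.* x ℤ.^ k                      ≡⟨ ℤ.*-assoc c x _ ⟩
    c ℤ.* (x ℤ.* x ℤ.^ k)                    ∎
    where open ≡-Reasoning

poly<-resp : (∀ r → g r ≡ h r) → Poly< d g → Poly< d h
poly<-resp g≗h (v , g≡v) = v , λ r → trans (sym (g≗h r)) (g≡v r)

poly<-0 : Poly< d (λ _ → + 0)
poly<-0 {d} = replicate d (+ 0) , λ r → sym (evalPoly-replicate (+ r) d)

poly<-monomial : (c : ℤ) → k < d → Poly< d (λ r → c ℤ.* (+ r) ℤ.^ k)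
poly<-monomial {k = k} c k<d =
  padRight k<d (+ 0) (monomial c k) , λ r → sym (trans (evalPoly-padRight (+ r) k<d _) (evalPoly-monomial (+ r) c k))

poly<-+ : Poly< d g → Poly< d h → Poly< d (λ r → g r ℤ.+ h r)
poly<-+ (u , g≡u) (v , h≡v) =
  zipWith ℤ._+_ u v , λ r → trans (cong₂ ℤ._+_ (g≡u r) (h≡v r)) (sym (evalPoly-zipWith (+ r) u v))

poly<-− : Poly< d g → Poly< d h → Poly< d (λ r → g r ℤ.- h r)
poly<-− p (v , h≡v) = poly<-+ p (Vec.map -_ v , λ r → trans (cong -_ (h≡v r)) (sym (evalPoly-neg (+ r) v)))

poly<-weaken : d ≤ d′ → Poly< d g → Poly< d′ g
poly<-weaken d≤d′ (v , g≡v) = padRight d≤d′ (+ 0) v , λ r → trans (g≡v r) (sym (evalPoly-padRight (+ r) d≤d′ v))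

‖_‖ : Vec ℤ d → ℕ
‖ []    ‖ = 0
‖ c ∷ v ‖ = ℤ.∣ c ∣ + ‖ v ‖

n≤n^1+d : ∀ n d → n ≤ n ^ suc d
n≤n^1+d zero      d = z≤n
n≤n^1+d n@(suc _) d = subst (_≤ n ^ suc d) (ℕ.*-identityʳ n) (ℕ.^-monoʳ-≤ n {1} {suc d} (s≤s z≤n))

∣+n^d∣ : ∀ n d → ℤ.∣ (+ n) ℤ.^ d ∣ ≡ n ^ d
∣+n^d∣ n zero    = refl
∣+n^d∣ n (suc d) = trans (ℤ.abs-* (+ n) ((+ n) ℤ.^ d)) (cong (n *_) (∣+n^d∣ n d))

∣evalPoly∣*r≤ : (v : Vec ℤ d) (r : ℕ) → ℤ.∣ evalPoly v (+ r) ∣ * r ≤ ‖ v ‖ * r ^ d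
∣evalPoly∣*r≤ []      r = z≤n
∣evalPoly∣*r≤ {suc d} (c ∷ v) r = begin
  ℤ.∣ c ℤ.+ + r ℤ.* e ∣ * r              ≤⟨ ℕ.*-monoˡ-≤ r (ℤ.∣i+j∣≤∣i∣+∣j∣ c (+ r ℤ.* e)) ⟩
  (ℤ.∣ c ∣ + ℤ.∣ + r ℤ.* e ∣) * r        ≡⟨ cong (λ z → (ℤ.∣ c ∣ + z) * r) (ℤ.abs-* (+ r) e) ⟩
  (ℤ.∣ c ∣ + r * ℤ.∣ e ∣) * r            ≡⟨ distribute ℤ.∣ c ∣ r ℤ.∣ e ∣ ⟩
  ℤ.∣ c ∣ * r + r * (ℤ.∣ e ∣ * r)        ≤⟨ ℕ.+-mono-≤ (ℕ.*-monoʳ-≤ ℤ.∣ c ∣ (n≤n^1+d r d))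
                                                        (ℕ.*-monoʳ-≤ r (∣evalPoly∣*r≤ v r)) ⟩
  ℤ.∣ c ∣ * (r * r ^ d) + r * (‖ v ‖ * r ^ d) ≡⟨ collect ℤ.∣ c ∣ r (r ^ d) ‖ v ‖ ⟩
  (ℤ.∣ c ∣ + ‖ v ‖) * (r * r ^ d)        ∎
  where
  open ℕ.≤-Reasoning
  e = evalPoly v (+ r)
  distribute : ∀ a r b → (a + r * b) * r ≡ a * r + r * (b * r)
  distribute = ℕ-Ring.solve-∀
  collect : ∀ a r p b → a * (r * p) + r * (b * p) ≡ (a + b) * (r * p)
  collect = ℕ-Ring.solve-∀

poly<-leading : (c : ℤ) → Poly< d (λ r → c ℤ.* (+ r) ℤ.^ d) → c ≡ + 0
poly<-leading {d} c (v , c*r^d≡v) = from-bound ℤ.∣ c ∣ refl bound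
  where
  R = suc ‖ v ‖
  -- At r = R the bound ∣evalPoly∣*r≤ leaves no room for ∣ c ∣ ≥ 1.
  bound : ℤ.∣ c ∣ * R ^ d * R ≤ ‖ v ‖ * R ^ d
  bound = begin
    ℤ.∣ c ∣ * R ^ d * R                 ≡⟨ cong (λ z → ℤ.∣ c ∣ * z * R) (∣+n^d∣ R d) ⟨
    ℤ.∣ c ∣ * ℤ.∣ (+ R) ℤ.^ d ∣ * R     ≡⟨ cong (_* R) (ℤ.abs-* c ((+ R) ℤ.^ d)) ⟨
    ℤ.∣ c ℤ.* (+ R) ℤ.^ d ∣ * R         ≡⟨ cong (λ z → ℤ.∣ z ∣ * R) (c*r^d≡v R) ⟩
    ℤ.∣ evalPoly v (+ R) ∣ * R          ≤⟨ ∣evalPoly∣*r≤ v R ⟩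
    ‖ v ‖ * R ^ d                       ∎
    where open ℕ.≤-Reasoning
  from-bound : ∀ n → ℤ.∣ c ∣ ≡ n → n * R ^ d * R ≤ ‖ v ‖ * R ^ d → c ≡ + 0
  from-bound zero    ∣c∣≡0 _     = ℤ.∣i∣≡0⇒i≡0 ∣c∣≡0
  from-bound (suc a) _    bound′ = ⊥-elim (ℕ.<-irrefl refl (ℕ.*-cancelʳ-≤ R ‖ v ‖ (R ^ d) {{ℕ.m^n≢0 R d}} (begin
    R * R ^ d          ≡⟨ ℕ.*-comm R (R ^ d) ⟩
    R ^ d * R          ≤⟨ ℕ.*-monoˡ-≤ R (ℕ.m≤m+n (R ^ d) (a * R ^ d)) ⟩
    suc a * R ^ d * R  ≤⟨ bound′ ⟩
    ‖ v ‖ * R ^ d      ∎)))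
    where open ℕ.≤-Reasoning

-- Inclusion–exclusion over the s-simplices

monochromeAvoidingCount : (m r : ℕ) → List (Subset m) → List (Subset m) → ℕ
monochromeAvoidingCount m r A H =
  count (λ c → all (monochrome c) A ∧ not (any (monochrome c) H)) (colourings m r)

monochromeAvoidingCount-[] : ∀ m r (A : List (Subset m)) → monochromeAvoidingCount m r A [] ≡ monochromeCount m r A
monochromeAvoidingCount-[] m r A = count-cong (λ c → ∧-identityʳ (all (monochrome c) A)) (colourings m r)

monochromeAvoidingCount-∷ : ∀ m r (A : List (Subset m)) h H →
  monochromeAvoidingCount m r A H ≡ monochromeAvoidingCount m r A (h ∷ H) + monochromeAvoidingCount m r (h ∷ A) H
monochromeAvoidingCount-∷ m r A h H = trans
  (count-split _ (λ c → monochrome c h) (colourings m r))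
  (cong₂ _+_ (count-cong (λ c → avoid-h (all (monochrome c) A) (any (monochrome c) H) (monochrome c h)) (colourings m r))
             (count-cong (λ c → force-h (all (monochrome c) A) (any (monochrome c) H) (monochrome c h)) (colourings m r)))
  where
  avoid-h : ∀ a b q → (a ∧ not b) ∧ not q ≡ a ∧ not (q ∨ b)
  avoid-h true  true  true  = refl
  avoid-h true  true  false = refl
  avoid-h true  false true  = refl
  avoid-h true  false false = refl
  avoid-h false _     _     = refl
  force-h : ∀ a b q → (a ∧ not b) ∧ q ≡ (q ∧ a) ∧ not b
  force-h true  true  true  = refl
  force-h true  true  false = refl
  force-h true  false true  = refl
  force-h true  false false = refl
  force-h false _     true  = refl
  force-h false _     false = refl

m≡n+o⇒+n≡+m-+o : ∀ {a b c} → a ≡ b + c → + b ≡ + a ℤ.- + c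
m≡n+o⇒+n≡+m-+o {b = b} {c} refl = trans (sym (cancel (+ b) (+ c))) (cong (ℤ._- + c) (sym (ℤ.pos-+ b c)))
  where
  cancel : ∀ x y → (x ℤ.+ y) ℤ.- y ≡ x
  cancel = ℤ-Ring.solve-∀

pos-^ : ∀ n d → + (n ^ d) ≡ (+ n) ℤ.^ d
pos-^ n zero    = refl
pos-^ n (suc d) = trans (ℤ.pos-* n (n ^ d)) (cong (+ n ℤ.*_) (pos-^ n d))

module _ (m s : ℕ) (0<m : 0 < m) (0<s : 0 < s) where

  Φ : List (Subset m) → List (Subset m) → ℕ → ℤ
  Φ A H r = + monochromeAvoidingCount m r A H

  Φ-[] : ∀ A r → Φ A [] r ≡ (+ r) ℤ.^ components m A
  Φ-[] A r = trans (cong +_ (trans (monochromeAvoidingCount-[] m r A) (monochromeCount≡ m r A 0<m)))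
                   (pos-^ r (components m A))

  Φ-∷ : ∀ A h H r → Φ A (h ∷ H) r ≡ Φ A H r ℤ.- Φ (h ∷ A) H r
  Φ-∷ A h H r = m≡n+o⇒+n≡+m-+o (monochromeAvoidingCount-∷ m r A h H)

  Φ-two-simplices : ∀ {A σ τ} → σ ∈ₗ A → τ ∈ₗ A → σ ≢ τ → ∣ σ ∣ ≡ suc s → ∣ τ ∣ ≡ suc s →
                    ∀ H → Poly< (m ∸ s) (Φ A H)
  Φ-two-simplices {A} σ∈A τ∈A σ≢τ ∣σ∣≡1+s ∣τ∣≡1+s [] =
    poly<-resp (λ r → trans (ℤ.*-identityˡ _) (sym (Φ-[] A r)))
      (poly<-monomial (+ 1) (components<∸ m s 0<s σ∈A τ∈A σ≢τ ∣σ∣≡1+s ∣τ∣≡1+s))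
  Φ-two-simplices {A} σ∈A τ∈A σ≢τ ∣σ∣≡1+s ∣τ∣≡1+s (h ∷ H) =
    poly<-resp (λ r → sym (Φ-∷ A h H r))
      (poly<-− (Φ-two-simplices σ∈A τ∈A σ≢τ ∣σ∣≡1+s ∣τ∣≡1+s H)
               (Φ-two-simplices {h ∷ A} (Any.there σ∈A) (Any.there τ∈A) σ≢τ ∣σ∣≡1+s ∣τ∣≡1+s H))

  Φ-one-simplex : ∀ {σ} → ∣ σ ∣ ≡ suc s → ∀ {H} → All (λ τ → ∣ τ ∣ ≡ suc s) H → All (σ ≢_) H →
                  Poly< (m ∸ s) (λ r → Φ (σ ∷ []) H r ℤ.- (+ r) ℤ.^ (m ∸ s))
  Φ-one-simplex {σ} ∣σ∣≡1+s {[]} _ _ = poly<-resp vanish poly<-0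
    where
    vanish : ∀ r → + 0 ≡ Φ (σ ∷ []) [] r ℤ.- (+ r) ℤ.^ (m ∸ s)
    vanish r rewrite Φ-[] (σ ∷ []) r | components-⁅σ⁆ m σ | ∣σ∣≡1+s = sym (ℤ.+-inverseʳ ((+ r) ℤ.^ (m ∸ s)))
  Φ-one-simplex {σ} ∣σ∣≡1+s {τ ∷ H} (∣τ∣≡1+s ∷ sizes) (σ≢τ ∷ σ≢H) =
    poly<-resp (λ r → trans (swap (Φ (σ ∷ []) H r) ((+ r) ℤ.^ (m ∸ s)) (Φ (τ ∷ σ ∷ []) H r))
                            (cong (ℤ._- (+ r) ℤ.^ (m ∸ s)) (sym (Φ-∷ (σ ∷ []) τ H r))))
      (poly<-− (Φ-one-simplex ∣σ∣≡1+s sizes σ≢H)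
               (Φ-two-simplices {τ ∷ σ ∷ []} (Any.here refl) (Any.there (Any.here refl)) (σ≢τ ∘ sym)
                                ∣τ∣≡1+s ∣σ∣≡1+s H))
    where
    swap : ∀ a x c → (a ℤ.- x) ℤ.- c ≡ (a ℤ.- c) ℤ.- x
    swap = ℤ-Ring.solve-∀

  Φ-simplices : ∀ {H} → All (λ τ → ∣ τ ∣ ≡ suc s) H → Unique H →
                Poly< (m ∸ s) (λ r → Φ [] H r ℤ.- ((+ r) ℤ.^ m ℤ.- + length H ℤ.* (+ r) ℤ.^ (m ∸ s)))
  Φ-simplices {[]} _ _ = poly<-resp vanish poly<-0
    where
    vanish : ∀ r → + 0 ≡ Φ [] [] r ℤ.- ((+ r) ℤ.^ m ℤ.- + 0 ℤ.* (+ r) ℤ.^ (m ∸ s))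
    vanish r rewrite Φ-[] [] r | components-[] m = cancel ((+ r) ℤ.^ m) ((+ r) ℤ.^ (m ∸ s))
      where
      cancel : ∀ x y → + 0 ≡ x ℤ.- (x ℤ.- + 0 ℤ.* y)
      cancel = ℤ-Ring.solve-∀
  Φ-simplices {σ ∷ H} (∣σ∣≡1+s ∷ sizes) (σ≢H ∷ unique) =
    poly<-resp (λ r → trans (regroup (Φ [] H r) (Φ (σ ∷ []) H r) ((+ r) ℤ.^ m) ((+ r) ℤ.^ (m ∸ s)) (+ length H))
                            (cong₂ (λ a n → a ℤ.- ((+ r) ℤ.^ m ℤ.- n ℤ.* (+ r) ℤ.^ (m ∸ s)))
                                   (sym (Φ-∷ [] σ H r)) (sym (ℤ.pos-+ 1 (length H)))))
      (poly<-− (Φ-simplices sizes unique) (Φ-one-simplex ∣σ∣≡1+s sizes σ≢H))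
    where
    regroup : ∀ a b x y n → (a ℤ.- (x ℤ.- n ℤ.* y)) ℤ.- (b ℤ.- y) ≡ (a ℤ.- b) ℤ.- (x ℤ.- (+ 1 ℤ.+ n) ℤ.* y)
    regroup = ℤ-Ring.solve-∀

subsets-unique : ∀ m → Unique (subsets m)
subsets-unique zero    = [] ∷ []
subsets-unique (suc m) =
  Unique.++⁺ (Unique.map⁺ ∷-injectiveʳ (subsets-unique m)) (Unique.map⁺ ∷-injectiveʳ (subsets-unique m)) heads-differ
  where
  heads-differ : ∀ {σ} → ¬ (σ ∈ₗ map (outside ∷_) (subsets m) × σ ∈ₗ map (inside ∷_) (subsets m))
  heads-differ (σ∈out , σ∈in) with ∈-map⁻ (outside ∷_) σ∈out | ∈-map⁻ (inside ∷_) σ∈in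
  ... | _ , _ , refl | _ , _ , ()

simplices-unique : ∀ {m} s (K : SimplicialComplex m) → Unique (simplices s K)
simplices-unique {m} s K = Unique.filter⁺ (T? ∘ λ σ → isFace K σ ∧ (∣ σ ∣ ≡ᵇ suc s)) (subsets-unique m)

simplices-size : ∀ {m} s (K : SimplicialComplex m) → All (λ σ → ∣ σ ∣ ≡ suc s) (simplices s K)
simplices-size {m} s K = All.map (λ {σ} face∧size → ℕ.≡ᵇ⇒≡ ∣ σ ∣ (suc s) (proj₂ (Equivalence.to T-∧ face∧size)))
  (Allₚ.all-filter (T? ∘ λ σ → isFace K σ ∧ (∣ σ ∣ ≡ᵇ suc s)) (subsets m))

χ-shape : ∀ m s (K : SimplicialComplex m) → 0 < m → 0 < s →
  Poly< (m ∸ s) (λ r → + χ s K r ℤ.- ((+ r) ℤ.^ m ℤ.- + f s K ℤ.* (+ r) ℤ.^ (m ∸ s)))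
χ-shape m s K 0<m 0<s = Φ-simplices m s 0<m 0<s (simplices-size s K) (simplices-unique s K)

m∸n<m : ∀ {m n} → 0 < m → 0 < n → m ∸ n < m
m∸n<m {suc m} {suc n} _ _ = s≤s (ℕ.m∸n≤m m n)

module _ {s : ℕ} (φ : ℕ → ℤ) where

  Shape : ℕ → ℤ → Set
  Shape m F = Poly< (m ∸ s) (λ r → φ r ℤ.- ((+ r) ℤ.^ m ℤ.- F ℤ.* (+ r) ℤ.^ (m ∸ s)))

  shape-<-shape⇒⊥ : ∀ {m m′ F F′} → m < m′ → 0 < m′ → 0 < s → Shape m F → Shape m′ F′ → ⊥
  shape-<-shape⇒⊥ {m} {m′} {F} {F′} m<m′ 0<m′ 0<s shape shape′ =
    one≢zero (poly<-leading (+ 1) (poly<-resp (λ r → solve (φ r) (x r) (y r) (x′ r) (y′ r) F F′)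
      (poly<-+ (poly<-− (poly<-− (poly<-+ (poly<-weaken (ℕ.<⇒≤ m∸s<m′) shape) (poly<-monomial (+ 1) m<m′))
                                 (poly<-monomial F m∸s<m′))
                        (poly<-weaken (ℕ.<⇒≤ m′∸s<m′) shape′))
               (poly<-monomial F′ m′∸s<m′))))
    where
    x y x′ y′ : ℕ → ℤ
    x r = (+ r) ℤ.^ m
    y r = (+ r) ℤ.^ (m ∸ s)
    x′ r = (+ r) ℤ.^ m′
    y′ r = (+ r) ℤ.^ (m′ ∸ s)
    m∸s<m′ = ℕ.≤-<-trans (ℕ.m∸n≤m m s) m<m′
    m′∸s<m′ = m∸n<m 0<m′ 0<s
    one≢zero : + 1 ≢ + 0
    one≢zero ()
    solve : ∀ φ x y x′ y′ f f′ →
      φ ℤ.- (x ℤ.- f ℤ.* y) ℤ.+ + 1 ℤ.* x ℤ.- f ℤ.* y ℤ.- (φ ℤ.- (x′ ℤ.- f′ ℤ.* y′)) ℤ.+ f′ ℤ.* y′ ≡ + 1 ℤ.* x′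
    solve = ℤ-Ring.solve-∀

  shape-coefficient : ∀ {m F F′} → Shape m F → Shape m F′ → F ≡ F′
  shape-coefficient {m} {F} {F′} shape shape′ =
    ℤ.i-j≡0⇒i≡j F F′ (poly<-leading (F ℤ.- F′) (poly<-resp
      (λ r → solve (φ r) ((+ r) ℤ.^ m) ((+ r) ℤ.^ (m ∸ s)) F F′) (poly<-− shape shape′)))
    where
    solve : ∀ φ x y f f′ → φ ℤ.- (x ℤ.- f ℤ.* y) ℤ.- (φ ℤ.- (x ℤ.- f′ ℤ.* y)) ≡ (f ℤ.- f′) ℤ.* y
    solve = ℤ-Ring.solve-∀

  shape-unique : ∀ {m m′ F F′} → 0 < m → 0 < m′ → 0 < s → Shape m F → Shape m′ F′ → m ≡ m′ × F ≡ F′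
  shape-unique {m} {m′} {F} {F′} 0<m 0<m′ 0<s shape shape′ with ℕ.<-cmp m m′
  ... | tri< m<m′ _ _ = ⊥-elim (shape-<-shape⇒⊥ {F = F} {F′} m<m′ 0<m′ 0<s shape shape′)
  ... | tri> _ _ m′<m = ⊥-elim (shape-<-shape⇒⊥ {F = F′} {F} m′<m 0<m 0<s shape′ shape)
  ... | tri≈ _ refl _ = refl , shape-coefficient {F = F} {F′} shape shape′

χ-expansion : ∀ m s (K : SimplicialComplex m) → 0 < m → 0 < s →
  Σ (Vec ℤ (m ∸ s)) (λ R → ∀ r →
    + χ s K r ≡ ((+ r) ℤ.^ m ℤ.- + f s K ℤ.* (+ r) ℤ.^ (m ∸ s)) ℤ.+ evalPoly R (+ r))
χ-expansion m s K 0<m 0<s with R , χ-P≡R ← χ-shape m s K 0<m 0<s =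
  R , λ r → trans (split (+ χ s K r) (P r)) (cong (ℤ._+_ (P r)) (χ-P≡R r))
  where
  P : ℕ → ℤ
  P r = (+ r) ℤ.^ m ℤ.- + f s K ℤ.* (+ r) ℤ.^ (m ∸ s)
  split : ∀ x p → x ≡ p ℤ.+ (x ℤ.- p)
  split = ℤ-Ring.solve-∀

χ-determines : ∀ m m′ s (K : SimplicialComplex m) (L : SimplicialComplex m′) → 0 < m → 0 < m′ → 0 < s →
  (∀ r → χ s K r ≡ χ s L r) → m ≡ m′ × f s K ≡ f s L
χ-determines m m′ s K L 0<m 0<m′ 0<s χK≡χL
  with m≡m′ , fK≡fL ← shape-unique (λ r → + χ s K r) 0<m 0<m′ 0<s (χ-shape m s K 0<m 0<s)
         (poly<-resp (λ r → cong (λ z → + z ℤ.- ((+ r) ℤ.^ m′ ℤ.- + f s L ℤ.* (+ r) ℤ.^ (m′ ∸ s)))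
                                 (sym (χK≡χL r)))
                     (χ-shape m′ s L 0<m′ 0<s))
  = m≡m′ , ℤ.+-injective fK≡fL

corollary2p25 :
    ((m s : ℕ) (K : SimplicialComplex m) → 1 ≤ m → 1 ≤ s →
      Σ (Vec ℤ (m ∸ s)) (λ R → (r : ℕ) →
        + (χ s K r) ≡ ((+ r) ℤ.^ m ℤ.- + (f s K) ℤ.* (+ r) ℤ.^ (m ∸ s)) ℤ.+ evalPoly R (+ r)))
    ×
    ((m m′ s : ℕ) (K : SimplicialComplex m) (L : SimplicialComplex m′) → 1 ≤ m → 1 ≤ m′ → 1 ≤ s →
      ((r : ℕ) → χ s K r ≡ χ s L r) → (m ≡ m′) × (f s K ≡ f s L))
corollary2p25 = χ-expansion , χ-determines
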